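{- Let $i\in\mathbb{N}$ ($i\ge1$) and let $G$ be any finite simple graph of order $n$ and size $m$. Then $E(G\circ\overline{K_i},x)=x^{in}(1+x)^m$.
   Context: For graphs $G$ and $H$, the corona $G\circ H$ is the graph obtained from the disjoint union of $G$ and $|V(G)|$ copies of $H$ by joining the $j$th vertex of $G$ to every vertex of the $j$th copy of $H$. $\overline{K_i}$ is the edgeless graph on $i$ vertices. An edge covering of a graph with no isolated vertex is a set of edges such that every vertex is incident with at least one edge of the set. For a graph $H$ of size $m_H$, $e(H,j)$ denotes the number of edge coverings of $H$ of cardinality $j$, $\rho(H)$ is the minimum size of an edge covering, and the edge cover polynomial is $E(H,x)=\sum_{j=\rho(H)}^{m_H} e(H,j)x^j$; by convention $E(H,x)=0$ if $H$ has an isolated vertex, and $E(H,x)=1$ if $H$ has no vertices and no edges. -}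

module Defs where

open import Data.Nat using (ℕ; zero; suc; _+_; _*_; _^_; _≡ᵇ_)
open import Data.Bool using (Bool; true; false; _∧_; _∨_; if_then_else_)
open import Data.Fin using (Fin; splitAt; remQuot; _<?_; _≟_)
open import Data.Sum using (_⊎_; inj₁; inj₂)
open import Data.Product using (_×_; _,_; proj₁; proj₂)
open import Data.List using (List; []; _∷_; filter; length; map; concatMap; allFin; upTo)
open import Data.Bool.ListAction using (all; any)
open import Data.Nat.ListAction using (sum)
open import Data.Bool using (T?)
open import Relation.Nullary using (does)
open import Relation.Binary.PropositionalEquality using (_≡_; refl; sym; cong; cong₂)

record Graph (n : ℕ) : Set where
  field
    adj    : Fin n → Fin n → Bool
    adj-sym : ∀ u v → adj u v ≡ adj v u
    adj-irr : ∀ u → adj u u ≡ false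
open Graph public

order : ∀ {n} → Graph n → ℕ
order {n} _ = n

edges : ∀ {n} → Graph n → List (Fin n × Fin n)
edges {n} G =
  concatMap (λ u → map (λ v → (u , v))
                       (filter (λ v → u <? v) (filter (λ v → T? (adj G u v)) (allFin n))))
            (allFin n)


size : ∀ {n} → Graph n → ℕ
size G = length (edges G)

sublists : ∀ {A : Set} → List A → List (List A)
sublists []       = [] ∷ []
sublists (x ∷ xs) = let r = sublists xs in map (x ∷_) r Data.List.++ r
  where import Data.List

isEdgeCovering : ∀ {n} → List (Fin n × Fin n) → Bool
isEdgeCovering {n} S =
  all (λ w → any (λ e → does (proj₁ e ≟ w) ∨ does (proj₂ e ≟ w)) S) (allFin n)

e : ∀ {n} → Graph n → ℕ → ℕ
e H j = length (filter (λ S → T? ((length S ≡ᵇ j) ∧ isEdgeCovering S)) (sublists (edges H)))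

-- edge cover polynomial, as a polynomial function evaluated at x:
-- E(H , x) = Σ_{j = 0}^{m_H} e(H , j) x^j
-- (e(H,j) = 0 for j < ρ(H); with an isolated vertex all e(H,j) = 0,
--  and for the empty graph E = 1, matching the conventions)
E : ∀ {n} → Graph n → ℕ → ℕ
E H x = sum (map (λ j → e H j * x ^ j) (upTo (suc (size H))))

K̄ : (i : ℕ) → Graph i
K̄ i = record { adj = λ _ _ → false ; adj-sym = λ _ _ → refl ; adj-irr = λ _ → refl }

-- corona G ∘ H: vertices Fin (n + n * k); the first n are the vertices of G,
-- a vertex in the second block with remQuot = (j , t) is vertex t of the j-th copy of H.
private
  sameB : ∀ {n} (a b : Fin n) → does (a ≟ b) ≡ does (b ≟ a)
  sameB a b with a ≟ b | b ≟ a
  ... | Relation.Nullary.yes _ | Relation.Nullary.yes _ = refl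
  ... | Relation.Nullary.no _  | Relation.Nullary.no _  = refl
  ... | Relation.Nullary.yes p | Relation.Nullary.no q  = Data.Empty.⊥-elim (q (sym p))
    where import Data.Empty
  ... | Relation.Nullary.no q  | Relation.Nullary.yes p = Data.Empty.⊥-elim (q (sym p))
    where import Data.Empty

  selfB : ∀ {n} (a : Fin n) → does (a ≟ a) ≡ true
  selfB a with a ≟ a
  ... | Relation.Nullary.yes _ = refl
  ... | Relation.Nullary.no q  = Data.Empty.⊥-elim (q refl)
    where import Data.Empty

_∘G_ : ∀ {n k} → Graph n → Graph k → Graph (n + n * k)
_∘G_ {n} {k} G H = record { adj = A ; adj-sym = As ; adj-irr = Ai }
  where
  A' : Fin n ⊎ (Fin n × Fin k) → Fin n ⊎ (Fin n × Fin k) → Bool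
  A' (inj₁ a)       (inj₁ b)       = adj G a b
  A' (inj₁ a)       (inj₂ (j , t)) = does (a ≟ j)
  A' (inj₂ (j , t)) (inj₁ a)       = does (j ≟ a)
  A' (inj₂ (j , t)) (inj₂ (l , s)) = does (j ≟ l) ∧ adj H t s
  dec : Fin (n + n * k) → Fin n ⊎ (Fin n × Fin k)
  dec u with splitAt n u
  ... | inj₁ a = inj₁ a
  ... | inj₂ c = inj₂ (remQuot k c)
  A : Fin (n + n * k) → Fin (n + n * k) → Bool
  A u v = A' (dec u) (dec v)
  As' : ∀ p q → A' p q ≡ A' q p
  As' (inj₁ a) (inj₁ b) = adj-sym G a b
  As' (inj₁ a) (inj₂ (j , t)) = sameB a j
  As' (inj₂ (j , t)) (inj₁ a) = sameB j a
  As' (inj₂ (j , t)) (inj₂ (l , s)) = cong₂ _∧_ (sameB j l) (adj-sym H t s)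
  As : ∀ u v → A u v ≡ A v u
  As u v = As' (dec u) (dec v)
  Ai' : ∀ p → A' p p ≡ false
  Ai' (inj₁ a) = adj-irr G a
  Ai' (inj₂ (j , t)) rewrite selfB j = adj-irr H t
  Ai : ∀ u → A u u ≡ false
  Ai u = Ai' (dec u)

module Submission where

-- In H = G ∘ K̄ᵢ every vertex of a copy of K̄ᵢ is a leaf whose unique (pendant)
-- edge lies in every edge covering; as i ≥ 1 the i n pendant edges already cover
-- all vertices, and each of the m edges of G may be added or not.

open import Defs
open import Data.Nat using (ℕ; zero; suc; _+_; _*_; _^_; _≤_; _<_; _≥_; _≡ᵇ_; z≤n; s≤s; s≤s⁻¹; _≤?_)
open import Data.Nat.Properties using (+-commutativeSemigroup; +-assoc; +-identityʳ; *-identityˡ; *-identityʳ; *-zeroʳ; *-distribˡ-+; *-distribʳ-+; *-comm; ≤-refl; ≤-trans; m≤m+n; m≤n+m; m≤n⇒m≤1+n; <⇒≱; m+n≡0⇒n≡0; 1+n≢0; n≤0⇒n≡0; module ≤-Reasoning)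
open import Algebra.Properties.CommutativeSemigroup +-commutativeSemigroup using (interchange)
open import Data.Bool using (Bool; true; false; _∧_; _∨_; not; if_then_else_; T; T?)
open import Data.Bool.Properties using (∨-assoc; ∨-zeroʳ; ∨-identityʳ; ∧-zeroʳ)
open import Data.Fin using (Fin; zero; suc; _↑ˡ_; _↑ʳ_; _≟_; _<?_; splitAt; remQuot; combine; toℕ)
open import Data.Fin.Properties using (splitAt-↑ˡ; splitAt-↑ʳ; toℕ-↑ˡ; toℕ-↑ʳ; ↑ʳ-injective; remQuot-combine; splitAt⁻¹-↑ˡ; splitAt⁻¹-↑ʳ; toℕ<n)
open import Data.Product using (_×_; _,_; proj₁; proj₂; Σ-syntax)
open import Data.Sum using (_⊎_; inj₁; inj₂; [_,_]′)
open import Data.List using (List; []; _∷_; _++_; map; filter; length; concatMap; allFin; upTo; applyUpTo)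
open import Data.List.Properties using (map-++; map-cong; map-∘; map-tabulate; length-tabulate)
open import Data.Bool.ListAction using (all; any; and)
open import Data.Nat.ListAction using (sum)
open import Data.Nat.ListAction.Properties using (sum-++)
open import Data.List.Relation.Unary.All as All using (All; []; _∷_)
import Data.List.Relation.Unary.All.Properties as AllP
open import Data.List.Relation.Unary.Any using (here; there)
open import Data.List.Membership.Propositional using (_∈_)
open import Data.List.Membership.Propositional.Properties using (∈-allFin)
open import Relation.Nullary using (Dec; does; yes; no; ¬_)
open import Relation.Nullary.Decidable using (dec-true; dec-false)
open import Relation.Unary using (Decidable)
open import Relation.Binary.PropositionalEquality
open import Data.Empty using (⊥-elim)
open import Function using (_∘_)
open import Data.Nat.Solver using (module +-*-Solver)
open +-*-Solver using (solve; _:=_; _:*_; _:+_; con)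

Σ' : {A : Set} → List A → (A → ℕ) → ℕ
Σ' xs f = sum (map f xs)

ind : Bool → ℕ
ind b = if b then 1 else 0

Σ-cong : ∀ {A : Set} (xs : List A) {f g : A → ℕ} → (∀ a → f a ≡ g a) → Σ' xs f ≡ Σ' xs g
Σ-cong xs eq = cong sum (map-cong eq xs)

Σ-congᴬ : ∀ {A : Set} {xs : List A} {f g : A → ℕ} → All (λ a → f a ≡ g a) xs → Σ' xs f ≡ Σ' xs g
Σ-congᴬ []       = refl
Σ-congᴬ (p ∷ ps) = cong₂ _+_ p (Σ-congᴬ ps)

Σ-zero : ∀ {A : Set} (xs : List A) {f : A → ℕ} → (∀ a → f a ≡ 0) → Σ' xs f ≡ 0
Σ-zero []       eq = refl
Σ-zero (a ∷ xs) eq = cong₂ _+_ (eq a) (Σ-zero xs eq)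

Σ-+ : ∀ {A : Set} (xs : List A) (f g : A → ℕ) → Σ' xs (λ a → f a + g a) ≡ Σ' xs f + Σ' xs g
Σ-+ []       f g = refl
Σ-+ (a ∷ xs) f g = trans (cong (f a + g a +_) (Σ-+ xs f g)) (interchange (f a) (g a) (Σ' xs f) (Σ' xs g))

Σ-*ˡ : ∀ {A : Set} (xs : List A) c (f : A → ℕ) → Σ' xs (λ a → c * f a) ≡ c * Σ' xs f
Σ-*ˡ []       c f = sym (*-zeroʳ c)
Σ-*ˡ (a ∷ xs) c f = trans (cong (c * f a +_) (Σ-*ˡ xs c f)) (sym (*-distribˡ-+ c (f a) (Σ' xs f)))

Σ-*ʳ : ∀ {A : Set} (xs : List A) c (f : A → ℕ) → Σ' xs (λ a → f a * c) ≡ Σ' xs f * c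
Σ-*ʳ []       c f = refl
Σ-*ʳ (a ∷ xs) c f = trans (cong (f a * c +_) (Σ-*ʳ xs c f)) (sym (*-distribʳ-+ c (f a) (Σ' xs f)))

Σ-swap : ∀ {A B : Set} (xs : List A) (ys : List B) (f : A → B → ℕ) →
         Σ' xs (λ a → Σ' ys (f a)) ≡ Σ' ys (λ b → Σ' xs (λ a → f a b))
Σ-swap []       ys f = sym (Σ-zero ys (λ _ → refl))
Σ-swap (a ∷ xs) ys f = trans (cong (Σ' ys (f a) +_) (Σ-swap xs ys f)) (sym (Σ-+ ys (f a) (λ b → Σ' xs (λ a' → f a' b))))

Σ-++ : ∀ {A : Set} (xs ys : List A) (f : A → ℕ) → Σ' (xs ++ ys) f ≡ Σ' xs f + Σ' ys f
Σ-++ xs ys f = trans (cong sum (map-++ f xs ys)) (sum-++ (map f xs) (map f ys))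

Σ-map : ∀ {A B : Set} (xs : List A) (g : A → B) (f : B → ℕ) → Σ' (map g xs) f ≡ Σ' xs (f ∘ g)
Σ-map xs g f = cong sum (sym (map-∘ xs))

Σ-concatMap : ∀ {A B : Set} (xs : List A) (g : A → List B) (f : B → ℕ) →
              Σ' (concatMap g xs) f ≡ Σ' xs (λ a → Σ' (g a) f)
Σ-concatMap []       g f = refl
Σ-concatMap (a ∷ xs) g f = trans (Σ-++ (g a) (concatMap g xs) f) (cong (Σ' (g a) f +_) (Σ-concatMap xs g f))

Σ-filter : ∀ {A : Set} {p} {P : A → Set p} (P? : Decidable P) (xs : List A) (f : A → ℕ) →
           Σ' (filter P? xs) f ≡ Σ' xs (λ a → if does (P? a) then f a else 0)
Σ-filter P? []       f = refl
Σ-filter P? (a ∷ xs) f with does (P? a)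
... | true  = cong (f a +_) (Σ-filter P? xs f)
... | false = Σ-filter P? xs f

length-Σ : ∀ {A : Set} (xs : List A) → length xs ≡ Σ' xs (λ _ → 1)
length-Σ []       = refl
length-Σ (a ∷ xs) = cong suc (length-Σ xs)

Σ-ind-zero : ∀ {A : Set} (p : A → Bool) (xs : List A) → Σ' xs (ind ∘ p) ≡ 0 → All (λ a → p a ≡ false) xs
Σ-ind-zero p []       _ = []
Σ-ind-zero p (a ∷ xs) h with p a in pa
... | false = pa ∷ Σ-ind-zero p xs h
... | true  with () ← h

Σ-allFin-suc : ∀ n (f : Fin (suc n) → ℕ) → Σ' (allFin (suc n)) f ≡ f zero + Σ' (allFin n) (f ∘ suc)
Σ-allFin-suc n f = cong (f zero +_) (cong sum (trans (map-tabulate suc f) (sym (map-tabulate (λ a → a) (f ∘ suc)))))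

Σ-allFin-+ : ∀ n k (f : Fin (n + k) → ℕ) →
             Σ' (allFin (n + k)) f ≡ Σ' (allFin n) (λ a → f (a ↑ˡ k)) + Σ' (allFin k) (λ c → f (n ↑ʳ c))
Σ-allFin-+ zero    k f = refl
Σ-allFin-+ (suc n) k f = begin
  Σ' (allFin (suc n + k)) f
    ≡⟨ Σ-allFin-suc (n + k) f ⟩
  f zero + Σ' (allFin (n + k)) (f ∘ suc)
    ≡⟨ cong (f zero +_) (Σ-allFin-+ n k (f ∘ suc)) ⟩
  f zero + (Σ' (allFin n) (λ a → f (suc a ↑ˡ k)) + Σ' (allFin k) (λ c → f (suc n ↑ʳ c)))
    ≡⟨ sym (+-assoc (f zero) _ _) ⟩
  f zero + Σ' (allFin n) (λ a → f (suc a ↑ˡ k)) + Σ' (allFin k) (λ c → f (suc n ↑ʳ c))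
    ≡⟨ cong (_+ Σ' (allFin k) (λ c → f (suc n ↑ʳ c))) (sym (Σ-allFin-suc n (λ a → f (a ↑ˡ k)))) ⟩
  Σ' (allFin (suc n)) (λ a → f (a ↑ˡ k)) + Σ' (allFin k) (λ c → f (suc n ↑ʳ c)) ∎
  where open ≡-Reasoning

Σ-allFin-point : ∀ n (w : Fin n) (φ : Fin n → ℕ) → Σ' (allFin n) (λ a → if does (a ≟ w) then φ a else 0) ≡ φ w
Σ-allFin-point (suc n) zero    φ =
  trans (Σ-allFin-suc n (λ a → if does (a ≟ zero) then φ a else 0))
        (trans (cong (φ zero +_) (Σ-zero (allFin n) (λ _ → refl))) (+-identityʳ (φ zero)))
Σ-allFin-point (suc n) (suc w) φ =
  trans (Σ-allFin-suc n (λ a → if does (a ≟ suc w) then φ a else 0)) (Σ-allFin-point n w (φ ∘ suc))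

term≤Σ-allFin : ∀ n (f : Fin n → ℕ) w → f w ≤ Σ' (allFin n) f
term≤Σ-allFin (suc n) f zero    = subst (f zero ≤_) (sym (Σ-allFin-suc n f)) (m≤m+n (f zero) _)
term≤Σ-allFin (suc n) f (suc w) = subst (f (suc w) ≤_) (sym (Σ-allFin-suc n f))
                                    (≤-trans (term≤Σ-allFin n (f ∘ suc) w) (m≤n+m _ (f zero)))

map-applyUpTo : ∀ {A : Set} (g : ℕ → A) (f : A → ℕ) M → map f (applyUpTo g M) ≡ applyUpTo (f ∘ g) M
map-applyUpTo g f zero    = refl
map-applyUpTo g f (suc M) = cong (f (g 0) ∷_) (map-applyUpTo (g ∘ suc) f M)

Σ-applyUpTo-point : ∀ M l (φ : ℕ → ℕ) → l < M → sum (applyUpTo (λ j → if l ≡ᵇ j then φ j else 0) M) ≡ φ l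
Σ-applyUpTo-point (suc M) zero    φ _         = trans (cong (φ 0 +_) (sum-zeros M)) (+-identityʳ (φ 0))
  where
  sum-zeros : ∀ M → sum (applyUpTo (λ _ → 0) M) ≡ 0
  sum-zeros zero    = refl
  sum-zeros (suc M) = sum-zeros M
Σ-applyUpTo-point (suc M) (suc l) φ (s≤s l<M) = Σ-applyUpTo-point M l (φ ∘ suc) l<M

all-ext : ∀ {A : Set} (xs : List A) {f g : A → Bool} → (∀ a → f a ≡ g a) → all f xs ≡ all g xs
all-ext xs eq = cong and (map-cong eq xs)

all-false : ∀ {A : Set} {xs : List A} (f : A → Bool) {a} → a ∈ xs → f a ≡ false → all f xs ≡ false
all-false f (here refl) fa rewrite fa = refl
all-false {xs = b ∷ _} f (there a∈) fa rewrite all-false f a∈ fa = ∧-zeroʳ (f b)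

all-true : ∀ {A : Set} (xs : List A) (f : A → Bool) → (∀ a → f a ≡ true) → all f xs ≡ true
all-true []       f t = refl
all-true (a ∷ xs) f t rewrite t a = all-true xs f t

sublists-length≤ : ∀ {A : Set} (L : List A) → All (λ S → length S ≤ length L) (sublists L)
sublists-length≤ []       = z≤n ∷ []
sublists-length≤ (a ∷ xs) = AllP.++⁺ (AllP.map⁺ (All.map s≤s (sublists-length≤ xs)))
                                     (All.map m≤n⇒m≤1+n (sublists-length≤ xs))

Edge : ℕ → Set
Edge N = Fin N × Fin N

hits : ∀ {N} → Edge N → Fin N → Bool
hits e w = does (proj₁ e ≟ w) ∨ does (proj₂ e ≟ w)

hits-endpoint : ∀ {N} (e : Edge N) w → hits e w ≡ true → proj₁ e ≡ w ⊎ proj₂ e ≡ w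
hits-endpoint e w h with proj₁ e ≟ w | proj₂ e ≟ w
... | yes p | _     = inj₁ p
... | no _  | yes q = inj₂ q

hits-second : ∀ {N} (e : Edge N) → hits e (proj₂ e) ≡ true
hits-second e = trans (cong (does (proj₁ e ≟ proj₂ e) ∨_) (dec-true (proj₂ e ≟ proj₂ e) refl)) (∨-zeroʳ _)

_∪ᵉ_ : ∀ {N} → (Fin N → Bool) → Edge N → Fin N → Bool
(C ∪ᵉ e) w = C w ∨ hits e w

covers : ∀ {N} → (Fin N → Bool) → List (Edge N) → Bool
covers {N} C S = all (λ w → C w ∨ any (λ e → hits e w) S) (allFin N)

coverSum : ∀ {N} → ℕ → List (Edge N) → (Fin N → Bool) → ℕ
coverSum x L C = Σ' (sublists L) (λ S → if covers C S then x ^ length S else 0)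

∅ : ∀ {N} → Fin N → Bool
∅ _ = false

coverSum-step : ∀ {N} x (e : Edge N) L C → coverSum x (e ∷ L) C ≡ x * coverSum x L (C ∪ᵉ e) + coverSum x L C
coverSum-step {N} x e L C =
  trans (Σ-++ (map (e ∷_) (sublists L)) (sublists L) _)
    (cong (_+ coverSum x L C)
      (trans (Σ-map (sublists L) (e ∷_) _)
        (trans (Σ-cong (sublists L) with-e) (Σ-*ˡ (sublists L) x _))))
  where
  if-* : ∀ b y → (if b then x * y else 0) ≡ x * (if b then y else 0)
  if-* true  y = refl
  if-* false y = sym (*-zeroʳ x)
  with-e : ∀ S → (if covers C (e ∷ S) then x ^ length (e ∷ S) else 0)
                 ≡ x * (if covers (C ∪ᵉ e) S then x ^ length S else 0)
  with-e S = trans (cong (λ b → if b then x * x ^ length S else 0)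
                     (all-ext (allFin N) (λ w → sym (∨-assoc (C w) (hits e w) (any (λ e' → hits e' w) S)))))
                   (if-* (covers (C ∪ᵉ e) S) (x ^ length S))

coverSum-untouched : ∀ {N} x (L : List (Edge N)) C w → C w ≡ false → All (λ e → hits e w ≡ false) L → coverSum x L C ≡ 0
coverSum-untouched x []      C w Cw _ = cong (λ b → ind b + 0) (all-false _ (∈-allFin w) (cong (_∨ false) Cw))
coverSum-untouched x (e ∷ L) C w Cw (ew ∷ Lw) = begin
  coverSum x (e ∷ L) C                     ≡⟨ coverSum-step x e L C ⟩
  x * coverSum x L (C ∪ᵉ e) + coverSum x L C ≡⟨ cong₂ (λ p q → x * p + q) (coverSum-untouched x L (C ∪ᵉ e) w (cong₂ _∨_ Cw ew) Lw)
                                                                          (coverSum-untouched x L C w Cw Lw) ⟩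
  x * 0 + 0                                ≡⟨ trans (+-identityʳ (x * 0)) (*-zeroʳ x) ⟩
  0                                        ∎
  where open ≡-Reasoning

-- The edge cover polynomial is the covering sum of the edge list with nothing
-- precovered: summing e(H , j) x^j over j ≤ m just regroups the subsets by size.
E-as-coverSum : ∀ {N} (H : Graph N) x → E H x ≡ coverSum x (edges H) ∅
E-as-coverSum {N} H x = begin
  E H x
    ≡⟨ Σ-cong js (λ j → cong (_* x ^ j) (trans (length-Σ (filter (P? j) subs)) (Σ-filter (P? j) subs (λ _ → 1)))) ⟩
  Σ' js (λ j → Σ' subs (λ S → ind (P S j)) * x ^ j)
    ≡⟨ Σ-cong js (λ j → sym (Σ-*ʳ subs (x ^ j) (λ S → ind (P S j)))) ⟩
  Σ' js (λ j → Σ' subs (λ S → ind (P S j) * x ^ j))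
    ≡⟨ Σ-swap js subs (λ j S → ind (P S j) * x ^ j) ⟩
  Σ' subs (λ S → Σ' js (λ j → ind (P S j) * x ^ j))
    ≡⟨ Σ-congᴬ (All.map (λ {S} → size-sum S) (sublists-length≤ (edges H))) ⟩
  coverSum x (edges H) ∅ ∎
  where
  open ≡-Reasoning
  js : List ℕ
  js = upTo (suc (size H))
  subs : List (List (Edge N))
  subs = sublists (edges H)
  P : List (Edge N) → ℕ → Bool
  P S j = (length S ≡ᵇ j) ∧ isEdgeCovering S
  P? : ∀ j (S : List (Edge N)) → Dec (T (P S j))
  P? j S = T? (P S j)
  point : ∀ l c j → ind ((l ≡ᵇ j) ∧ c) * x ^ j ≡ (if l ≡ᵇ j then (if c then x ^ j else 0) else 0)
  point l c j with l ≡ᵇ j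
  ... | false = refl
  ... | true with c
  ...   | true  = *-identityˡ (x ^ j)
  ...   | false = refl
  -- only the size j = |S| contributes, and |S| ≤ m lies in the range of j
  size-sum : ∀ S → length S ≤ size H → Σ' js (λ j → ind (P S j) * x ^ j) ≡ (if isEdgeCovering S then x ^ length S else 0)
  size-sum S S≤m = trans (Σ-cong js (point (length S) (isEdgeCovering S)))
    (trans (cong sum (map-applyUpTo (λ j → j) _ (suc (size H))))
           (Σ-applyUpTo-point (suc (size H)) (length S) (λ j → if isEdgeCovering S then x ^ j else 0) (s≤s S≤m)))

-- If no edge
-- starts at a leaf and each leaf lies on at most one edge, pendant edges are
-- forced in every covering and all other edges are free.
module Leaves {N : ℕ} (leaf : Fin N → Bool) where

  pendant : Edge N → Bool
  pendant e = leaf (proj₂ e)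

  pendantHits : List (Edge N) → Fin N → ℕ
  pendantHits L w = Σ' L (λ e → ind (pendant e ∧ hits e w))

  hitByPendant : List (Edge N) → Fin N → Bool
  hitByPendant L w = any (λ e → pendant e ∧ hits e w) L

  #pendant #free : List (Edge N) → ℕ
  #pendant L = Σ' L (λ e → ind (pendant e))
  #free    L = Σ' L (λ e → ind (not (pendant e)))

  coveredIndicator : List (Edge N) → (Fin N → Bool) → ℕ
  coveredIndicator L C = ind (all (λ w → C w ∨ hitByPendant L w) (allFin N))

  closedForm : ℕ → List (Edge N) → (Fin N → Bool) → ℕ
  closedForm x L C = x ^ #pendant L * (1 + x) ^ #free L * coveredIndicator L C

  record Admissible (L : List (Edge N)) (C : Fin N → Bool) : Set where
    field
      innerStart   : All (λ e → leaf (proj₁ e) ≡ false) L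
      leafPrivate  : ∀ w → leaf w ≡ true → pendantHits L w ≤ 1
      leafFresh    : ∀ w → leaf w ≡ true → C w ≡ true → pendantHits L w ≡ 0
      innerCovered : ∀ w → leaf w ≡ false → hitByPendant L w ≡ false → C w ≡ true
  open Admissible

  hitByPendant-pos : ∀ L w → 1 ≤ pendantHits L w → hitByPendant L w ≡ true
  hitByPendant-pos (e ∷ L) w h with pendant e ∧ hits e w
  ... | true  = refl
  ... | false = hitByPendant-pos L w h

  leaf-at-second : ∀ e w → leaf (proj₁ e) ≡ false → hits e w ≡ true → leaf w ≡ true → proj₂ e ≡ w
  leaf-at-second e w start h lw with hits-endpoint e w h
  ... | inj₂ q = q
  ... | inj₁ refl with () ← trans (sym lw) start

  untouched-leaf : ∀ L w → All (λ e → leaf (proj₁ e) ≡ false) L → leaf w ≡ true →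
                   pendantHits L w ≡ 0 → All (λ e → hits e w ≡ false) L
  untouched-leaf []      w _ _ _ = []
  untouched-leaf (e ∷ L) w (start ∷ starts) lw zero-hits with hits e w in h
  ... | false = h ∷ untouched-leaf L w starts lw (m+n≡0⇒n≡0 (ind (pendant e ∧ false)) zero-hits)
  ... | true = ⊥-elim (1+n≢0 (subst (λ b → ind (b ∧ true) + pendantHits L w ≡ 0) pendant-e zero-hits))
    where
    pendant-e : pendant e ≡ true
    pendant-e = trans (cong leaf (leaf-at-second e w start h lw)) lw

  -- A pendant first edge e = (a , b): its leaf b lies on no other edge and is not
  -- precovered, so e belongs to every covering; after using it, the rest of the
  -- list is admissible for C ∪ e.
  module PendantHead {e : Edge N} {L : List (Edge N)} {C : Fin N → Bool}
                     (pe : pendant e ≡ true) (adm : Admissible (e ∷ L) C) where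

    private
      b : Fin N
      b = proj₂ e

    pendantHits-head : ∀ w → pendantHits (e ∷ L) w ≡ ind (hits e w) + pendantHits L w
    pendantHits-head w = cong (λ p → ind (p ∧ hits e w) + pendantHits L w) pe

    pendantHits-b : pendantHits (e ∷ L) b ≡ suc (pendantHits L b)
    pendantHits-b = trans (pendantHits-head b) (cong (λ h → ind h + pendantHits L b) (hits-second e))

    leaf-b-private : pendantHits L b ≡ 0
    leaf-b-private = n≤0⇒n≡0 (s≤s⁻¹ (subst (_≤ 1) pendantHits-b (leafPrivate adm b pe)))

    leaf-b-uncovered : C b ≡ false
    leaf-b-uncovered with C b in Cb
    ... | false = refl
    ... | true  = ⊥-elim (1+n≢0 (trans (sym pendantHits-b) (leafFresh adm b pe Cb)))

    -- without e the leaf b cannot be covered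
    forced : ∀ x → coverSum x L C ≡ 0
    forced x = coverSum-untouched x L C b leaf-b-uncovered
                 (untouched-leaf L b (All.tail (innerStart adm)) pe leaf-b-private)

    -- the leaf b is now covered, so its privacy is no longer needed
    tail-admissible : Admissible L (C ∪ᵉ e)
    tail-admissible = record
      { innerStart   = All.tail (innerStart adm)
      ; leafPrivate  = λ w lw → ≤-trans (m≤n+m _ _) (subst (_≤ 1) (pendantHits-head w) (leafPrivate adm w lw))
      ; leafFresh    = fresh
      ; innerCovered = covered
      }
      where
      fresh : ∀ w → leaf w ≡ true → (C ∪ᵉ e) w ≡ true → pendantHits L w ≡ 0
      fresh w lw C∪e-w with C w in Cw
      ... | true  = m+n≡0⇒n≡0 _ (trans (sym (pendantHits-head w)) (leafFresh adm w lw Cw))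
      ... | false = subst (λ v → pendantHits L v ≡ 0) (leaf-at-second e w (All.head (innerStart adm)) C∪e-w lw) leaf-b-private
      covered : ∀ w → leaf w ≡ false → hitByPendant L w ≡ false → (C ∪ᵉ e) w ≡ true
      covered w lw not-hit with hits e w in hw
      ... | true  = ∨-zeroʳ (C w)
      ... | false = trans (∨-identityʳ (C w))
                      (innerCovered adm w lw (trans (cong₂ (λ p h → (p ∧ h) ∨ hitByPendant L w) pe hw) not-hit))

    pendant-count : #pendant (e ∷ L) ≡ suc (#pendant L)
    pendant-count = cong (λ p → ind p + #pendant L) pe

    free-count : #free (e ∷ L) ≡ #free L
    free-count = cong (λ p → ind (not p) + #free L) pe

    indicator : coveredIndicator L (C ∪ᵉ e) ≡ coveredIndicator (e ∷ L) C
    indicator = cong ind (all-ext (allFin N) (λ w →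
      trans (∨-assoc (C w) (hits e w) (hitByPendant L w))
            (cong (λ p → C w ∨ ((p ∧ hits e w) ∨ hitByPendant L w)) (sym pe))))

    coverSum-cons : ∀ x → coverSum x L (C ∪ᵉ e) ≡ closedForm x L (C ∪ᵉ e) → coverSum x (e ∷ L) C ≡ closedForm x (e ∷ L) C
    coverSum-cons x ih = begin
      coverSum x (e ∷ L) C
        ≡⟨ coverSum-step x e L C ⟩
      x * coverSum x L (C ∪ᵉ e) + coverSum x L C
        ≡⟨ cong₂ (λ p q → x * p + q) ih (forced x) ⟩
      x * (x ^ #pendant L * (1 + x) ^ #free L * coveredIndicator L (C ∪ᵉ e)) + 0
        ≡⟨ solve 4 (λ x p f i → x :* (p :* f :* i) :+ con 0 := x :* p :* f :* i) refl
                   x (x ^ #pendant L) ((1 + x) ^ #free L) (coveredIndicator L (C ∪ᵉ e)) ⟩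
      x ^ suc (#pendant L) * (1 + x) ^ #free L * coveredIndicator L (C ∪ᵉ e)
        ≡⟨ cong₂ (λ p f → x ^ p * (1 + x) ^ f * coveredIndicator L (C ∪ᵉ e)) (sym pendant-count) (sym free-count) ⟩
      x ^ #pendant (e ∷ L) * (1 + x) ^ #free (e ∷ L) * coveredIndicator L (C ∪ᵉ e)
        ≡⟨ cong (x ^ #pendant (e ∷ L) * (1 + x) ^ #free (e ∷ L) *_) indicator ⟩
      closedForm x (e ∷ L) C ∎
      where open ≡-Reasoning

  -- A free first edge: both endpoints are inner vertices, which are covered
  -- anyway, so the edge may be used or not at will.
  module FreeHead {e : Edge N} {L : List (Edge N)} {C : Fin N → Bool}
                  (pf : pendant e ≡ false) (adm : Admissible (e ∷ L) C) where

    pendantHits-head : ∀ w → pendantHits (e ∷ L) w ≡ pendantHits L w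
    pendantHits-head w = cong (λ p → ind (p ∧ hits e w) + pendantHits L w) pf

    hitByPendant-head : ∀ w → hitByPendant (e ∷ L) w ≡ hitByPendant L w
    hitByPendant-head w = cong (λ p → (p ∧ hits e w) ∨ hitByPendant L w) pf

    inner-endpoint : ∀ w → hits e w ≡ true → leaf w ≡ false
    inner-endpoint w hw with leaf w in lw
    ... | false = refl
    ... | true  with () ← trans (sym pf) (trans (cong leaf (leaf-at-second e w (All.head (innerStart adm)) hw lw)) lw)

    -- dropping or using e preserves the invariant, as it touches only inner vertices
    tail-admissible : Admissible L C
    tail-admissible = record
      { innerStart   = All.tail (innerStart adm)
      ; leafPrivate  = λ w lw → subst (_≤ 1) (pendantHits-head w) (leafPrivate adm w lw)
      ; leafFresh    = λ w lw Cw → trans (sym (pendantHits-head w)) (leafFresh adm w lw Cw)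
      ; innerCovered = λ w lw not-hit → innerCovered adm w lw (trans (hitByPendant-head w) not-hit)
      }
    open Admissible tail-admissible using () renaming (leafFresh to tailFresh; innerCovered to tailCovered)

    tail-admissible-∪ : Admissible L (C ∪ᵉ e)
    tail-admissible-∪ = record
      { innerStart   = All.tail (innerStart adm)
      ; leafPrivate  = leafPrivate tail-admissible
      ; leafFresh    = fresh
      ; innerCovered = λ w lw not-hit → cong (_∨ hits e w) (tailCovered w lw not-hit)
      }
      where
      fresh : ∀ w → leaf w ≡ true → (C ∪ᵉ e) w ≡ true → pendantHits L w ≡ 0
      fresh w lw C∪e-w with C w in Cw
      ... | true  = tailFresh w lw Cw
      ... | false with () ← trans (sym lw) (inner-endpoint w C∪e-w)

    pendant-count : #pendant (e ∷ L) ≡ #pendant L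
    pendant-count = cong (λ p → ind p + #pendant L) pf

    free-count : #free (e ∷ L) ≡ suc (#free L)
    free-count = cong (λ p → ind (not p) + #free L) pf

    -- Adding the endpoints of e changes nothing: they are inner, hence covered.
    indicator-∪ : coveredIndicator L (C ∪ᵉ e) ≡ coveredIndicator L C
    indicator-∪ = cong ind (all-ext (allFin N) pointwise)
      where
      pointwise : ∀ w → (C w ∨ hits e w) ∨ hitByPendant L w ≡ C w ∨ hitByPendant L w
      pointwise w with hits e w in hw | hitByPendant L w in hp
      ... | false | h     = cong (_∨ h) (∨-identityʳ (C w))
      ... | true  | true  = trans (∨-zeroʳ _) (sym (∨-zeroʳ _))
      ... | true  | false rewrite tailCovered w (inner-endpoint w hw) hp = refl

    indicator : coveredIndicator (e ∷ L) C ≡ coveredIndicator L C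
    indicator = cong ind (all-ext (allFin N) (λ w → cong (C w ∨_) (hitByPendant-head w)))

    coverSum-cons : ∀ x → coverSum x L (C ∪ᵉ e) ≡ closedForm x L (C ∪ᵉ e) → coverSum x L C ≡ closedForm x L C →
                    coverSum x (e ∷ L) C ≡ closedForm x (e ∷ L) C
    coverSum-cons x ih-∪ ih = begin
      coverSum x (e ∷ L) C
        ≡⟨ coverSum-step x e L C ⟩
      x * coverSum x L (C ∪ᵉ e) + coverSum x L C
        ≡⟨ cong₂ (λ p q → x * p + q) (trans ih-∪ (cong (x ^ #pendant L * (1 + x) ^ #free L *_) indicator-∪)) ih ⟩
      x * (x ^ #pendant L * (1 + x) ^ #free L * I) + x ^ #pendant L * (1 + x) ^ #free L * I
        ≡⟨ solve 4 (λ x p f i → x :* (p :* f :* i) :+ p :* f :* i := p :* ((con 1 :+ x) :* f) :* i) refl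
                   x (x ^ #pendant L) ((1 + x) ^ #free L) I ⟩
      x ^ #pendant L * (1 + x) ^ suc (#free L) * I
        ≡⟨ cong₂ (λ p f → x ^ p * (1 + x) ^ f * I) (sym pendant-count) (sym free-count) ⟩
      x ^ #pendant (e ∷ L) * (1 + x) ^ #free (e ∷ L) * I
        ≡⟨ cong (x ^ #pendant (e ∷ L) * (1 + x) ^ #free (e ∷ L) *_) (sym indicator) ⟩
      closedForm x (e ∷ L) C ∎
      where
      open ≡-Reasoning
      I : ℕ
      I = coveredIndicator L C

  coverSum-admissible : ∀ x L C → Admissible L C → coverSum x L C ≡ closedForm x L C
  coverSum-admissible x []      C adm = refl
  coverSum-admissible x (e ∷ L) C adm = by-head (pendant e) refl
    where
    by-head : ∀ p → pendant e ≡ p → coverSum x (e ∷ L) C ≡ closedForm x (e ∷ L) C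
    by-head true  pe = PendantHead.coverSum-cons pe adm x
                         (coverSum-admissible x L (C ∪ᵉ e) (PendantHead.tail-admissible pe adm))
    by-head false pf = FreeHead.coverSum-cons pf adm x
                         (coverSum-admissible x L (C ∪ᵉ e) (FreeHead.tail-admissible-∪ pf adm))
                         (coverSum-admissible x L C (FreeHead.tail-admissible pf adm))

edgeTerm : ∀ {N} (H : Graph N) (h : Edge N → ℕ) → Fin N → Fin N → ℕ
edgeTerm H h u v = if adj H u v then (if does (u <? v) then h (u , v) else 0) else 0

Σ-edges : ∀ {N} (H : Graph N) (h : Edge N → ℕ) →
          Σ' (edges H) h ≡ Σ' (allFin N) (λ u → Σ' (allFin N) (edgeTerm H h u))
Σ-edges {N} H h = trans (Σ-concatMap (allFin N) _ h) (Σ-cong (allFin N) (λ u →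
  trans (Σ-map (larger u) (u ,_) h)
    (trans (Σ-filter (λ v → u <? v) (neighbours u) (λ v → h (u , v)))
           (Σ-filter (λ v → T? (adj H u v)) (allFin N) (λ v → if does (u <? v) then h (u , v) else 0)))))
  where
  neighbours larger : Fin N → List (Fin N)
  neighbours u = filter (λ v → T? (adj H u v)) (allFin N)
  larger u = filter (λ v → u <? v) (neighbours u)

if-zero : ∀ b {y : ℕ} → y ≡ 0 → (if b then y else 0) ≡ 0
if-zero true  y≡0 = y≡0
if-zero false _   = refl

does-≟-injective : ∀ {m M} (f : Fin m → Fin M) → (∀ {a b} → f a ≡ f b → a ≡ b) → ∀ a b → does (f a ≟ f b) ≡ does (a ≟ b)
does-≟-injective f inj a b with a ≟ b | f a ≟ f b
... | yes _   | yes _   = refl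
... | yes a≡b | no fa≢fb = ⊥-elim (fa≢fb (cong f a≡b))
... | no a≢b  | yes fa≡fb = ⊥-elim (a≢b (inj fa≡fb))
... | no _    | no _    = refl

-- The corona H = G ∘ K̄ᵢ on Fin (n + n i): ι embeds the vertices of G, ρ the
-- vertices of the copies of K̄ᵢ, and vertex ρ c is a leaf attached to ι (owner c).
-- Every edge of H is either an edge ι a — ι b of G or a pendant edge ι (owner c) — ρ c.
module Corona (n i : ℕ) (G : Graph n) where
  k N : ℕ
  k = n * i
  N = n + k

  H : Graph N
  H = G ∘G K̄ i

  L : List (Edge N)
  L = edges H

  ι : Fin n → Fin N
  ι a = a ↑ˡ k

  ρ : Fin k → Fin N
  ρ c = n ↑ʳ c

  owner : Fin k → Fin n
  owner c = proj₁ (remQuot {n} i c)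

  leaf : Fin N → Bool
  leaf w = [ (λ _ → false) , (λ _ → true) ]′ (splitAt n w)

  open Leaves leaf

  leaf-ι : ∀ a → leaf (ι a) ≡ false
  leaf-ι a rewrite splitAt-↑ˡ n a k = refl

  leaf-ρ : ∀ c → leaf (ρ c) ≡ true
  leaf-ρ c rewrite splitAt-↑ʳ n k c = refl

  vertex-cases : ∀ w → (Σ[ a ∈ Fin n ] ι a ≡ w) ⊎ (Σ[ c ∈ Fin k ] ρ c ≡ w)
  vertex-cases w with splitAt n w in eq
  ... | inj₁ a = inj₁ (a , splitAt⁻¹-↑ˡ eq)
  ... | inj₂ c = inj₂ (c , splitAt⁻¹-↑ʳ eq)

  ι≢ρ : ∀ a c → does (ι a ≟ ρ c) ≡ false
  ι≢ρ a c = dec-false (ι a ≟ ρ c) (λ p → inj₁≢inj₂ (trans (sym (splitAt-↑ˡ n a k)) (trans (cong (splitAt n) p) (splitAt-↑ʳ n k c))))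
    where inj₁≢inj₂ : ¬ (inj₁ a ≡ inj₂ c)
          inj₁≢inj₂ ()

  adj-ιι : ∀ a b → adj H (ι a) (ι b) ≡ adj G a b
  adj-ιι a b rewrite splitAt-↑ˡ n a k | splitAt-↑ˡ n b k = refl

  adj-ιρ : ∀ a c → adj H (ι a) (ρ c) ≡ does (a ≟ owner c)
  adj-ιρ a c rewrite splitAt-↑ˡ n a k | splitAt-↑ʳ n k c = refl

  adj-ρρ : ∀ c d → adj H (ρ c) (ρ d) ≡ does (owner c ≟ owner d) ∧ false
  adj-ρρ c d rewrite splitAt-↑ʳ n k d | splitAt-↑ʳ n k c = refl

  <-ιι : ∀ a b → does (ι a <? ι b) ≡ does (a <? b)
  <-ιι a b = cong₂ (λ p q → does (suc p ≤? q)) (toℕ-↑ˡ a k) (toℕ-↑ˡ b k)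

  <-ιρ : ∀ a c → does (ι a <? ρ c) ≡ true
  <-ιρ a c = dec-true (ι a <? ρ c) (subst₂ (λ p q → suc p ≤ q) (sym (toℕ-↑ˡ a k)) (sym (toℕ-↑ʳ n c))
               (≤-trans (toℕ<n a) (m≤m+n n (toℕ c))))

  <-ρι : ∀ c b → does (ρ c <? ι b) ≡ false
  <-ρι c b = dec-false (ρ c <? ι b) (λ lt → <⇒≱ (toℕ<n b)
               (≤-trans (m≤m+n n (toℕ c)) (≤-trans (m≤n+m _ 1) (subst₂ (λ p q → suc p ≤ q) (toℕ-↑ʳ n c) (toℕ-↑ˡ b k) lt))))

  graphTerm : (Edge N → ℕ) → Fin n → Fin n → ℕ
  graphTerm h a b = if adj G a b then (if does (a <? b) then h (ι a , ι b) else 0) else 0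

  pendantTerm : (Edge N → ℕ) → Fin n → Fin k → ℕ
  pendantTerm h a c = if does (a ≟ owner c) then h (ι a , ρ c) else 0

  Σ-corona-edges : ∀ h → Σ' L h ≡ Σ' (allFin n) (λ a → Σ' (allFin n) (graphTerm h a) + Σ' (allFin k) (pendantTerm h a))
  Σ-corona-edges h = begin
    Σ' L h
      ≡⟨ Σ-edges H h ⟩
    Σ' (allFin N) (λ u → Σ' (allFin N) (edgeTerm H h u))
      ≡⟨ Σ-allFin-+ n k _ ⟩
    Σ' (allFin n) (λ a → Σ' (allFin N) (edgeTerm H h (ι a))) + Σ' (allFin k) (λ c → Σ' (allFin N) (edgeTerm H h (ρ c)))
      ≡⟨ cong₂ _+_ (Σ-cong (allFin n) from-ι) (Σ-zero (allFin k) from-ρ) ⟩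
    Σ' (allFin n) (λ a → Σ' (allFin n) (graphTerm h a) + Σ' (allFin k) (pendantTerm h a)) + 0
      ≡⟨ +-identityʳ _ ⟩
    Σ' (allFin n) (λ a → Σ' (allFin n) (graphTerm h a) + Σ' (allFin k) (pendantTerm h a)) ∎
    where
    open ≡-Reasoning
    from-ι : ∀ a → Σ' (allFin N) (edgeTerm H h (ι a)) ≡ Σ' (allFin n) (graphTerm h a) + Σ' (allFin k) (pendantTerm h a)
    from-ι a = trans (Σ-allFin-+ n k (edgeTerm H h (ι a))) (cong₂ _+_
      (Σ-cong (allFin n) (λ b → cong₂ (λ p q → if p then (if q then h (ι a , ι b) else 0) else 0) (adj-ιι a b) (<-ιι a b)))
      (Σ-cong (allFin k) (λ c → cong₂ (λ p q → if p then (if q then h (ι a , ρ c) else 0) else 0) (adj-ιρ a c) (<-ιρ a c))))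
    from-ρ : ∀ c → Σ' (allFin N) (edgeTerm H h (ρ c)) ≡ 0
    from-ρ c = trans (Σ-allFin-+ n k (edgeTerm H h (ρ c))) (cong₂ _+_
      (Σ-zero (allFin n) (λ b → trans (cong (λ q → if adj H (ρ c) (ι b) then (if q then h (ρ c , ι b) else 0) else 0) (<-ρι c b))
                                       (if-zero (adj H (ρ c) (ι b)) refl)))
      (Σ-zero (allFin k) (λ d → cong (λ p → if p then (if does (ρ c <? ρ d) then h (ρ c , ρ d) else 0) else 0)
                                      (trans (adj-ρρ c d) (∧-zeroʳ _)))))

  inner-start : Σ' L (λ e → ind (leaf (proj₁ e))) ≡ 0
  inner-start = trans (Σ-corona-edges _) (Σ-zero (allFin n) (λ a → cong₂ _+_
    (Σ-zero (allFin n) (λ b → if-zero (adj G a b) (if-zero (does (a <? b)) (cong ind (leaf-ι a)))))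
    (Σ-zero (allFin k) (λ c → if-zero (does (a ≟ owner c)) (cong ind (leaf-ι a))))))

  pendant-count : #pendant L ≡ i * n
  pendant-count = begin
    #pendant L
      ≡⟨ Σ-corona-edges _ ⟩
    Σ' (allFin n) (λ a → Σ' (allFin n) (graphTerm (ind ∘ pendant) a) + Σ' (allFin k) (pendantTerm (ind ∘ pendant) a))
      ≡⟨ Σ-cong (allFin n) (λ a → cong₂ _+_
           (Σ-zero (allFin n) (λ b → if-zero (adj G a b) (if-zero (does (a <? b)) (cong ind (leaf-ι b)))))
           (Σ-cong (allFin k) (λ c → cong (λ z → if does (a ≟ owner c) then z else 0) (cong ind (leaf-ρ c))))) ⟩
    Σ' (allFin n) (λ a → Σ' (allFin k) (λ c → if does (a ≟ owner c) then 1 else 0))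
      ≡⟨ Σ-swap (allFin n) (allFin k) _ ⟩
    Σ' (allFin k) (λ c → Σ' (allFin n) (λ a → if does (a ≟ owner c) then 1 else 0))
      ≡⟨ Σ-cong (allFin k) (λ c → Σ-allFin-point n (owner c) (λ _ → 1)) ⟩
    Σ' (allFin k) (λ _ → 1)
      ≡⟨ sym (length-Σ (allFin k)) ⟩
    length (allFin k)
      ≡⟨ trans (length-tabulate (λ c → c)) (*-comm n i) ⟩
    i * n ∎
    where open ≡-Reasoning

  free-count : #free L ≡ size G
  free-count = begin
    #free L
      ≡⟨ Σ-corona-edges _ ⟩
    Σ' (allFin n) (λ a → Σ' (allFin n) (graphTerm (ind ∘ not ∘ pendant) a) + Σ' (allFin k) (pendantTerm (ind ∘ not ∘ pendant) a))
      ≡⟨ Σ-cong (allFin n) (λ a → trans (cong₂ _+_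
           (Σ-cong (allFin n) (λ b → cong (λ z → if adj G a b then (if does (a <? b) then z else 0) else 0) (cong (ind ∘ not) (leaf-ι b))))
           (Σ-zero (allFin k) (λ c → if-zero (does (a ≟ owner c)) (cong (ind ∘ not) (leaf-ρ c))))) (+-identityʳ _)) ⟩
    Σ' (allFin n) (λ a → Σ' (allFin n) (edgeTerm G (λ _ → 1) a))
      ≡⟨ sym (trans (length-Σ (edges G)) (Σ-edges G (λ _ → 1))) ⟩
    size G ∎
    where open ≡-Reasoning

  pendantHits-ρ : ∀ c₀ → pendantHits L (ρ c₀) ≡ 1
  pendantHits-ρ c₀ = begin
    pendantHits L (ρ c₀)
      ≡⟨ Σ-corona-edges h ⟩
    Σ' (allFin n) (λ a → Σ' (allFin n) (graphTerm h a) + Σ' (allFin k) (pendantTerm h a))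
      ≡⟨ Σ-cong (allFin n) (λ a → cong₂ _+_
           (Σ-zero (allFin n) (λ b → if-zero (adj G a b) (if-zero (does (a <? b)) (cong (λ z → ind (z ∧ hits (ι a , ι b) (ρ c₀))) (leaf-ι b)))))
           (Σ-cong (allFin k) (λ c → cong (λ z → if does (a ≟ owner c) then z else 0) (hit-ρ a c)))) ⟩
    Σ' (allFin n) (λ a → Σ' (allFin k) (λ c → if does (a ≟ owner c) then ind (does (c ≟ c₀)) else 0))
      ≡⟨ Σ-swap (allFin n) (allFin k) _ ⟩
    Σ' (allFin k) (λ c → Σ' (allFin n) (λ a → if does (a ≟ owner c) then ind (does (c ≟ c₀)) else 0))
      ≡⟨ Σ-cong (allFin k) (λ c → Σ-allFin-point n (owner c) (λ _ → ind (does (c ≟ c₀)))) ⟩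
    Σ' (allFin k) (λ c → ind (does (c ≟ c₀)))
      ≡⟨ Σ-allFin-point k c₀ (λ _ → 1) ⟩
    1 ∎
    where
    open ≡-Reasoning
    h : Edge N → ℕ
    h e = ind (pendant e ∧ hits e (ρ c₀))
    hit-ρ : ∀ a c → h (ι a , ρ c) ≡ ind (does (c ≟ c₀))
    hit-ρ a c = trans (cong₂ (λ p q → ind (p ∧ (q ∨ does (ρ c ≟ ρ c₀)))) (leaf-ρ c) (ι≢ρ a c₀))
                      (cong ind (does-≟-injective ρ (↑ʳ-injective n _ _) c c₀))

  leaf-private : ∀ w → leaf w ≡ true → pendantHits L w ≤ 1
  leaf-private w lw with vertex-cases w
  ... | inj₁ (a , refl) with () ← trans (sym lw) (leaf-ι a)
  ... | inj₂ (c , refl) = subst (_≤ 1) (sym (pendantHits-ρ c)) ≤-refl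

  -- Since i ≥ 1, every vertex of G carries a leaf: vertex t of its copy of K̄ᵢ.
  module WithLeaf (t : Fin i) where

    -- the pendant edge to the leaf ρ (combine a₀ t) meets ι a₀
    pendantHits-ι : ∀ a₀ → 1 ≤ pendantHits L (ι a₀)
    pendantHits-ι a₀ = subst (1 ≤_) (sym (Σ-corona-edges h)) (begin
      1                                   ≡⟨ sym term-c₀ ⟩
      pendantTerm h a₀ c₀                 ≤⟨ term≤Σ-allFin k (pendantTerm h a₀) c₀ ⟩
      Σ' (allFin k) (pendantTerm h a₀)    ≤⟨ m≤n+m _ (Σ' (allFin n) (graphTerm h a₀)) ⟩
      Σ' (allFin n) (graphTerm h a₀) + Σ' (allFin k) (pendantTerm h a₀)
                                          ≤⟨ term≤Σ-allFin n (λ a → Σ' (allFin n) (graphTerm h a) + Σ' (allFin k) (pendantTerm h a)) a₀ ⟩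
      Σ' (allFin n) (λ a → Σ' (allFin n) (graphTerm h a) + Σ' (allFin k) (pendantTerm h a)) ∎)
      where
      open ≤-Reasoning
      h : Edge N → ℕ
      h e = ind (pendant e ∧ hits e (ι a₀))
      c₀ : Fin k
      c₀ = combine a₀ t
      h-c₀ : h (ι a₀ , ρ c₀) ≡ 1
      h-c₀ = cong₂ (λ p q → ind (p ∧ (q ∨ does (ρ c₀ ≟ ι a₀)))) (leaf-ρ c₀) (dec-true (ι a₀ ≟ ι a₀) refl)
      term-c₀ : pendantTerm h a₀ c₀ ≡ 1
      term-c₀ = trans (cong (λ p → if does (a₀ ≟ p) then h (ι a₀ , ρ c₀) else 0) (cong proj₁ (remQuot-combine a₀ t)))
                      (trans (cong (λ p → if p then h (ι a₀ , ρ c₀) else 0) (dec-true (a₀ ≟ a₀) refl)) h-c₀)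

    hitByPendant-everywhere : ∀ w → hitByPendant L w ≡ true
    hitByPendant-everywhere w with vertex-cases w
    ... | inj₁ (a , refl) = hitByPendant-pos L (ι a) (pendantHits-ι a)
    ... | inj₂ (c , refl) = hitByPendant-pos L (ρ c) (subst (1 ≤_) (sym (pendantHits-ρ c)) ≤-refl)

    admissible : Admissible L ∅
    admissible = record
      { innerStart   = Σ-ind-zero (leaf ∘ proj₁) L inner-start
      ; leafPrivate  = leaf-private
      ; leafFresh    = λ _ _ ()
      ; innerCovered = λ w _ not-hit → ⊥-elim (true≢false (trans (sym (hitByPendant-everywhere w)) not-hit))
      }
      where
      true≢false : ¬ (true ≡ false)
      true≢false ()

    everything-covered : coveredIndicator L ∅ ≡ 1
    everything-covered = cong ind (all-true (allFin N) _ hitByPendant-everywhere)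

corollary2p3 : (i : ℕ) → i ≥ 1 → (n : ℕ) (G : Graph n) (x : ℕ) →
    E (G ∘G K̄ i) x ≡ x ^ (i * n) * (1 + x) ^ size G
corollary2p3 zero () n G x
corollary2p3 i@(suc _) _ n G x = begin
  E H x
    ≡⟨ E-as-coverSum H x ⟩
  coverSum x L ∅
    ≡⟨ coverSum-admissible x L ∅ admissible ⟩
  closedForm x L ∅
    ≡⟨ cong₂ (λ p f → x ^ p * (1 + x) ^ f * coveredIndicator L ∅) pendant-count free-count ⟩
  x ^ (i * n) * (1 + x) ^ size G * coveredIndicator L ∅
    ≡⟨ cong (x ^ (i * n) * (1 + x) ^ size G *_) everything-covered ⟩
  x ^ (i * n) * (1 + x) ^ size G * 1
    ≡⟨ *-identityʳ _ ⟩
  x ^ (i * n) * (1 + x) ^ size G ∎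
  where
  open ≡-Reasoning
  open Corona n i G
  open Leaves leaf
  open WithLeaf zero
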